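{- Consider any graph with $m$ edges, $T\ge1$ triangles, $P_2$ length-2 paths, transitivity coefficient $\alpha=3T/P_2$, and at most $\Delta_E$ triangles sharing a common edge. Then there is an absolute constant $c>0$ such that \[ \frac{m}{\sqrt{T}}\left(\frac{P_2}{T}\right)^2\ \ge\ c\, m\left(\frac{\Delta_E}{T}+\frac{1}{\sqrt{T}}\right). \]
   Context: A length-2 path (wedge) is a pair of edges sharing exactly one endpoint. -}

module Defs where

open import Data.Nat using (ℕ; zero; suc; _⊔_)
open import Data.Bool using (Bool; true; false; if_then_else_; _∧_)
open import Data.Fin using (Fin; _<_; _<?_)
open import Data.Fin.Properties using (_≟_)
open import Data.List using (List; map; foldr; allFin)
open import Data.Nat.ListAction using (sum)
open import Data.Integer using (+_)
open import Data.Rational using (ℚ; _/_)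
open import Relation.Binary.PropositionalEquality using (_≡_)
open import Relation.Nullary using (¬_; Dec; does)

record SimpleGraph (n : ℕ) : Set₁ where
  field
    Adj     : Fin n → Fin n → Set
    adj?    : ∀ u v → Dec (Adj u v)
    symm    : ∀ {u v} → Adj u v → Adj v u
    irrefl  : ∀ {u} → ¬ Adj u u

module _ {n : ℕ} (G : SimpleGraph n) where
  open SimpleGraph G

  adjB : Fin n → Fin n → Bool
  adjB u v = does (adj? u v)

  ltB : Fin n → Fin n → Bool
  ltB u v = does (u <? v)

  neqB : Fin n → Fin n → Bool
  neqB u v = if does (u ≟ v) then false else true

  countFin : (Fin n → Bool) → ℕ
  countFin p = sum (map (λ i → if p i then 1 else 0) (allFin n))

  numEdges : ℕ
  numEdges = sum (map (λ u → countFin (λ v → ltB u v ∧ adjB u v)) (allFin n))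

  triOnEdge : Fin n → Fin n → ℕ
  triOnEdge u v = countFin (λ w → adjB u w ∧ adjB v w)

  numTriangles : ℕ
  numTriangles =
    sum (map (λ u → sum (map (λ v → countFin (λ w →
      ltB u v ∧ ltB v w ∧ adjB u v ∧ adjB v w ∧ adjB u w)) (allFin n))) (allFin n))

  -- P₂: number of length-2 paths (wedges), i.e. unordered pairs of edges
  -- sharing exactly one endpoint: a centre c and an unordered pair {u,w}
  -- (u < w) of distinct neighbours of c.  (Neighbours of c are ≠ c, and
  -- u ≠ w, so the two edges {c,u},{c,w} share exactly the endpoint c.)
  numWedges : ℕ
  numWedges =
    sum (map (λ c → sum (map (λ u → countFin (λ w →
      ltB u w ∧ adjB c u ∧ adjB c w)) (allFin n))) (allFin n))

  -- Δ_E: maximum, over edges, of the number of triangles sharing that edge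
  -- (0 if there are no edges).
  maxTriOnEdge : ℕ
  maxTriOnEdge =
    foldr _⊔_ 0 (map (λ u → foldr _⊔_ 0 (map (λ v →
      if adjB u v then triOnEdge u v else 0) (allFin n))) (allFin n))

ℕtoℚ : ℕ → ℚ
ℕtoℚ k = + k / 1

-- Both ratios on the right are controlled by the wedge count P.  Every triangle u < v < w
-- yields the wedge v – u – w, so T ≤ P.  The t triangles on an edge uv have their third
-- vertices among the other neighbours of u, so t < deg u and t² ≤ deg u (deg u − 1), which is
-- twice the number of wedges centred at u; hence Δ_E² ≤ 2P.  Now for 0 ≤ s ≤ √T we get
-- Δ_E s ≤ 2P (compare Δ_E with s), so Δ_E T s + T² ≤ 2P² + P² = 3P², and c = 1/3 works.
module Submission where

open import Defs

module Counting where
  open import Data.Nat hiding (_<ᵇ_)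
  open import Data.Nat.Properties
  open import Data.Bool using (Bool; true; false; if_then_else_; _∧_)
  open import Data.Fin using (Fin; zero; suc)
  open import Data.List using (map; foldr; allFin; tabulate)
  open import Data.List.Properties using (map-tabulate; foldr-preservesᵇ)
  open import Data.List.Relation.Unary.All.Properties using (tabulate⁺)
  open import Data.Nat.ListAction using (sum)
  open import Data.Sum using (inj₁; inj₂)
  open import Function using (id; _∘_)
  open import Relation.Binary.PropositionalEquality
  open import Relation.Nullary using (does; yes; no)
  open import Data.Empty using (⊥-elim)
  open import Algebra.Properties.Monoid.Sum +-0-monoid using (sum-cong-≗)
    renaming (sum to ∑)
  open import Data.Nat.Solver using (module +-*-Solver)

  𝟙 : Bool → ℕ
  𝟙 b = if b then 1 else 0

  sum-map-allFin : ∀ {n} (f : Fin n → ℕ) → sum (map f (allFin n)) ≡ ∑ f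
  sum-map-allFin f = trans (cong sum (map-tabulate id f)) (sum-tabulate f)
    where
    sum-tabulate : ∀ {n} (f : Fin n → ℕ) → sum (tabulate f) ≡ ∑ f
    sum-tabulate {zero}  f = refl
    sum-tabulate {suc n} f = cong (f zero +_) (sum-tabulate (f ∘ suc))

  ∑-mono-≤ : ∀ {n} {f g : Fin n → ℕ} → (∀ i → f i ≤ g i) → ∑ f ≤ ∑ g
  ∑-mono-≤ {zero}  f≤g = z≤n
  ∑-mono-≤ {suc n} f≤g = +-mono-≤ (f≤g zero) (∑-mono-≤ (f≤g ∘ suc))

  ∑-mono-< : ∀ {n} {f g : Fin n → ℕ} → (∀ i → f i ≤ g i) → ∀ j → f j < g j → ∑ f < ∑ g
  ∑-mono-< f≤g zero    fj<gj = +-mono-<-≤ fj<gj (∑-mono-≤ (f≤g ∘ suc))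
  ∑-mono-< f≤g (suc j) fj<gj = +-mono-≤-< (f≤g zero) (∑-mono-< (f≤g ∘ suc) j fj<gj)

  term≤∑ : ∀ {n} (f : Fin n → ℕ) j → f j ≤ ∑ f
  term≤∑ f zero    = m≤m+n _ _
  term≤∑ f (suc j) = ≤-trans (term≤∑ (f ∘ suc) j) (m≤n+m _ _)

  sum-mono-≤ : ∀ {n} {f g : Fin n → ℕ} → (∀ i → f i ≤ g i) →
               sum (map f (allFin n)) ≤ sum (map g (allFin n))
  sum-mono-≤ {f = f} {g} f≤g =
    subst₂ _≤_ (sym (sum-map-allFin f)) (sym (sum-map-allFin g)) (∑-mono-≤ f≤g)

  term≤sum : ∀ {n} (f : Fin n → ℕ) j → f j ≤ sum (map f (allFin n))
  term≤sum f j = subst (f j ≤_) (sym (sum-map-allFin f)) (term≤∑ f j)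

  -- A maximum is one of its arguments (or the initial 0), so it inherits any property they share.
  max-allFin-preserves : ∀ {n} (P : ℕ → Set) → P 0 → {f : Fin n → ℕ} → (∀ i → P (f i)) →
                  P (foldr _⊔_ 0 (map f (allFin n)))
  max-allFin-preserves P P0 {f} Pf =
    subst (P ∘ foldr _⊔_ 0) (sym (map-tabulate id f))
      (foldr-preservesᵇ {P = P} ⊔-preserves P0 (tabulate⁺ Pf))
    where
    ⊔-preserves : ∀ {x y} → P x → P y → P (x ⊔ y)
    ⊔-preserves {x} {y} Px Py with ⊔-sel x y
    ... | inj₁ x⊔y≡x = subst P (sym x⊔y≡x) Px
    ... | inj₂ x⊔y≡y = subst P (sym x⊔y≡y) Py

  countB : ∀ {n} → (Fin n → Bool) → ℕ
  countB p = ∑ (𝟙 ∘ p)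

  _<ᵇ_ : ∀ {n} → Fin n → Fin n → Bool
  a <ᵇ b = does (a Data.Fin.<? b)

  pairsB : ∀ {n} → (Fin n → Bool) → ℕ
  pairsB p = ∑ λ a → ∑ λ b → 𝟙 (a <ᵇ b ∧ p a ∧ p b)

  ∑-zero : ∀ n → ∑ {n} (λ _ → 0) ≡ 0
  ∑-zero zero    = refl
  ∑-zero (suc n) = ∑-zero n

  -- pairsB p counts the 2-element subsets of the support of p, so this is c² = 2 (c choose 2) + c.
  countB-square : ∀ {n} (p : Fin n → Bool) → countB p * countB p ≡ 2 * pairsB p + countB p
  countB-square {zero}  p = refl
  countB-square {suc n} p with p zero | countB-square (p ∘ suc)
  ... | false | ih = begin
    c * c                         ≡⟨ ih ⟩
    2 * w + c                     ≡⟨ cong (λ z → 2 * (z + w) + c) (sym (∑-zero n)) ⟩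
    2 * (∑ {n} (λ _ → 0) + w) + c ∎
    where open ≡-Reasoning; c = countB (p ∘ suc); w = pairsB (p ∘ suc)
  ... | true  | ih = begin
    suc c * suc c           ≡⟨ cong suc (+-comm c (c * suc c)) ⟩
    suc (c * suc c + c)     ≡⟨ cong (λ z → suc (z + c)) (*-suc c c) ⟩
    suc (c + c * c + c)     ≡⟨ cong (λ z → suc (c + z + c)) ih ⟩
    suc (c + (2 * w + c) + c) ≡⟨ cong suc (solve c w) ⟩
    suc (2 * (c + w) + c)   ≡⟨ +-suc (2 * (c + w)) c ⟨
    2 * (c + w) + suc c     ∎
    where
    open ≡-Reasoning
    c = countB (p ∘ suc); w = pairsB (p ∘ suc)
    solve : ∀ c w → c + (2 * w + c) + c ≡ 2 * (c + w) + c
    solve = +-*-Solver.solve 2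
      (λ c w → c :+ (con 2 :* w :+ c) :+ c := con 2 :* (c :+ w) :+ c) refl
      where open +-*-Solver

  square+≤square : ∀ {k c} → k < c → k * k + c ≤ c * c
  square+≤square {k} {suc c} (s≤s k≤c) = begin
    k * k + suc c       ≤⟨ +-monoˡ-≤ (suc c) (*-mono-≤ k≤c (m≤n⇒m≤1+n k≤c)) ⟩
    c * suc c + suc c   ≡⟨ +-comm (c * suc c) (suc c) ⟩
    suc c * suc c       ∎
    where open ≤-Reasoning

  square≤2*pairsB : ∀ {n} (p : Fin n → Bool) {k} → k < countB p → k * k ≤ 2 * pairsB p
  square≤2*pairsB p {k} k<c = +-cancelʳ-≤ (countB p) (k * k) (2 * pairsB p)
    (≤-trans (square+≤square k<c) (≤-reflexive (countB-square p)))

  𝟙-∧-≤ˡ : ∀ a b → 𝟙 (a ∧ b) ≤ 𝟙 a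
  𝟙-∧-≤ˡ false _ = z≤n
  𝟙-∧-≤ˡ true  b = 𝟙≤1 b
    where
    𝟙≤1 : ∀ b → 𝟙 b ≤ 1
    𝟙≤1 false = z≤n
    𝟙≤1 true  = ≤-refl

  triangle≤wedge : ∀ a b c d e → 𝟙 (a ∧ b ∧ c ∧ d ∧ e) ≤ 𝟙 (b ∧ c ∧ e)
  triangle≤wedge false _     _     _     _ = z≤n
  triangle≤wedge true  false _     _     _ = z≤n
  triangle≤wedge true  true  false _     _ = z≤n
  triangle≤wedge true  true  true  false _ = z≤n
  triangle≤wedge true  true  true  true  _ = ≤-refl

  module _ {n : ℕ} (G : SimpleGraph n) where
    open SimpleGraph G

    numTriangles≤numWedges : numTriangles G ≤ numWedges G
    numTriangles≤numWedges = sum-mono-≤ λ u → sum-mono-≤ λ v → sum-mono-≤ λ w →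
      triangle≤wedge (ltB G u v) (ltB G v w) (adjB G u v) (adjB G v w) (adjB G u w)

    degree : Fin n → ℕ
    degree u = countB (adjB G u)

    wedgesAt : Fin n → ℕ
    wedgesAt c = sum (map (λ u → countFin G (λ w → ltB G u w ∧ adjB G c u ∧ adjB G c w)) (allFin n))

    wedgesAt≡pairsB : ∀ c → wedgesAt c ≡ pairsB (adjB G c)
    wedgesAt≡pairsB c = trans (sum-map-allFin (λ u → countFin G (wedgeEnds u)))
      (sum-cong-≗ λ u → sum-map-allFin (𝟙 ∘ wedgeEnds u))
      where
      wedgeEnds : Fin n → Fin n → Bool
      wedgeEnds u w = ltB G u w ∧ adjB G c u ∧ adjB G c w

    wedgesAt≤numWedges : ∀ c → wedgesAt c ≤ numWedges G
    wedgesAt≤numWedges = term≤sum wedgesAt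

    adjB-true : ∀ {u v} → Adj u v → adjB G u v ≡ true
    adjB-true {u} {v} uv with adj? u v
    ... | yes _  = refl
    ... | no ¬uv = ⊥-elim (¬uv uv)

    adjB-irrefl : ∀ u → adjB G u u ≡ false
    adjB-irrefl u with adj? u u
    ... | yes uu = ⊥-elim (irrefl uu)
    ... | no _   = refl

    -- v is a neighbour of u but, having no loop, not a common neighbour of u and v.
    triOnEdge<degree : ∀ {u v} → Adj u v → triOnEdge G u v < degree u
    triOnEdge<degree {u} {v} uv =
      subst (_< degree u) (sym (sum-map-allFin (λ w → 𝟙 (adjB G u w ∧ adjB G v w))))
        (∑-mono-< (λ w → 𝟙-∧-≤ˡ (adjB G u w) (adjB G v w)) v
          (subst₂ (λ x y → 𝟙 (x ∧ y) < 𝟙 x) (sym (adjB-true uv)) (sym (adjB-irrefl v)) ≤-refl))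

    triOnEdge-square≤ : ∀ {u v} → Adj u v → triOnEdge G u v * triOnEdge G u v ≤ 2 * numWedges G
    triOnEdge-square≤ {u} {v} uv = ≤-trans (square≤2*pairsB (adjB G u) (triOnEdge<degree uv))
      (*-monoʳ-≤ 2 (subst (_≤ numWedges G) (wedgesAt≡pairsB u) (wedgesAt≤numWedges u)))

    maxTriOnEdge-square≤ : maxTriOnEdge G * maxTriOnEdge G ≤ 2 * numWedges G
    maxTriOnEdge-square≤ = max-allFin-preserves P z≤n λ u → max-allFin-preserves P z≤n λ v → onPair u v
      where
      P : ℕ → Set
      P x = x * x ≤ 2 * numWedges G
      onPair : ∀ u v → P (if adjB G u v then triOnEdge G u v else 0)
      onPair u v with adj? u v
      ... | yes uv = triOnEdge-square≤ uv
      ... | no _   = z≤n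

module RationalBounds where
  open import Data.Nat as ℕ using (ℕ)
  open import Data.Integer as ℤ using (+_)
  import Data.Integer.Properties as ℤ
  import Data.Nat.Properties as ℕₚ
  open import Data.Nat.Coprimality using (1-coprimeTo) renaming (sym to coprime-sym)
  open import Data.Rational
  open import Data.Rational.Properties
  open import Data.Rational.Solver using (module +-*-Solver)
  open import Data.Sum using (inj₁; inj₂)
  open import Relation.Binary.PropositionalEquality

  -- The normal form of k / 1, on which + and * compute without any gcd.
  ℕtoℚ-nf : ℕ → ℚ
  ℕtoℚ-nf k = mkℚ (+ k) 0 (coprime-sym (1-coprimeTo k))

  ℕtoℚ≡ℕtoℚ-nf : ∀ k → ℕtoℚ k ≡ ℕtoℚ-nf k
  ℕtoℚ≡ℕtoℚ-nf k = ↥p/↧p≡p (ℕtoℚ-nf k)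

  ℕtoℚ-* : ∀ a b → ℕtoℚ a * ℕtoℚ b ≡ ℕtoℚ (a ℕ.* b)
  ℕtoℚ-* a b rewrite ℕtoℚ≡ℕtoℚ-nf a | ℕtoℚ≡ℕtoℚ-nf b = cong (_/ 1) (ℤ.+◃n≡+n (a ℕ.* b))

  ℕtoℚ-+ : ∀ a b → ℕtoℚ a + ℕtoℚ b ≡ ℕtoℚ (a ℕ.+ b)
  ℕtoℚ-+ a b rewrite ℕtoℚ≡ℕtoℚ-nf a | ℕtoℚ≡ℕtoℚ-nf b =
    cong (_/ 1) (cong₂ ℤ._+_ (ℤ.*-identityʳ (+ a)) (ℤ.*-identityʳ (+ b)))

  ℕtoℚ-mono-≤ : ∀ {a b} → a ℕ.≤ b → ℕtoℚ a ≤ ℕtoℚ b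
  ℕtoℚ-mono-≤ {a} {b} a≤b rewrite ℕtoℚ≡ℕtoℚ-nf a | ℕtoℚ≡ℕtoℚ-nf b =
    *≤* (subst₂ ℤ._≤_ (sym (ℤ.*-identityʳ (+ a))) (sym (ℤ.*-identityʳ (+ b))) (ℤ.+≤+ a≤b))

  ℕtoℚ-nonNeg : ∀ a → 0ℚ ≤ ℕtoℚ a
  ℕtoℚ-nonNeg a = ℕtoℚ-mono-≤ {0} {a} ℕ.z≤n

  ℕtoℚ-double : ∀ a → ℕtoℚ (2 ℕ.* a) ≡ ℕtoℚ a + ℕtoℚ a
  ℕtoℚ-double a = sym (trans (ℕtoℚ-+ a a) (cong (λ x → ℕtoℚ (a ℕ.+ x)) (sym (ℕₚ.+-identityʳ a))))

  *-mono-≤-nonNeg : ∀ {a b c d} → 0ℚ ≤ b → 0ℚ ≤ c → a ≤ b → c ≤ d → a * c ≤ b * d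
  *-mono-≤-nonNeg {b = b} {c} 0≤b 0≤c a≤b c≤d =
    ≤-trans (*-monoʳ-≤-nonNeg c {{nonNegative 0≤c}} a≤b) (*-monoˡ-≤-nonNeg b {{nonNegative 0≤b}} c≤d)

  *≤-of-squares≤ : ∀ {x y b} → 0ℚ ≤ x → 0ℚ ≤ y → x * x ≤ b → y * y ≤ b → x * y ≤ b
  *≤-of-squares≤ {x} {y} 0≤x 0≤y x²≤b y²≤b with ≤-total x y
  ... | inj₁ x≤y = ≤-trans (*-monoʳ-≤-nonNeg y {{nonNegative 0≤y}} x≤y) y²≤b
  ... | inj₂ y≤x = ≤-trans (*-monoˡ-≤-nonNeg x {{nonNegative 0≤x}} y≤x) x²≤b

  wedge-bound : ∀ {D T P s} → 0ℚ ≤ D → 0ℚ ≤ T → T ≤ P → D * D ≤ P + P → 0ℚ ≤ s → s * s ≤ T →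
                D * T * s + T * T ≤ (P + P + P) * P
  wedge-bound {D} {T} {P} {s} 0≤D 0≤T T≤P D²≤2P 0≤s s²≤T = begin
    D * T * s + T * T     ≡⟨ cong (_+ T * T) (reorder D T s) ⟩
    D * s * T + T * T     ≤⟨ +-mono-≤ (*-mono-≤-nonNeg 0≤2P 0≤T Ds≤2P T≤P) (*-mono-≤-nonNeg 0≤P 0≤T T≤P T≤P) ⟩
    (P + P) * P + P * P   ≡⟨ *-distribʳ-+ P (P + P) P ⟨
    (P + P + P) * P       ∎
    where
    open ≤-Reasoning
    reorder : ∀ d t x → d * t * x ≡ d * x * t
    reorder = +-*-Solver.solve 3 (λ d t x → d :* t :* x := d :* x :* t) refl
      where open +-*-Solver
    0≤P : 0ℚ ≤ P
    0≤P = ≤-trans 0≤T T≤P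
    P≤2P : P ≤ P + P
    P≤2P = ≤-trans (≤-reflexive (sym (+-identityʳ P))) (+-monoʳ-≤ P 0≤P)
    0≤2P : 0ℚ ≤ P + P
    0≤2P = ≤-trans 0≤P P≤2P
    Ds≤2P : D * s ≤ P + P
    Ds≤2P = *≤-of-squares≤ 0≤D 0≤s D²≤2P (≤-trans s²≤T (≤-trans T≤P P≤2P))

  ⅓ : ℚ
  ⅓ = + 1 / 3

  ⅓-bound : ∀ {M X P} → 0ℚ ≤ M → X ≤ (P + P + P) * P → ⅓ * (M * X) ≤ M * (P * P)
  ⅓-bound {M} {X} {P} 0≤M X≤3P² = begin
    ⅓ * (M * X)                          ≤⟨ *-monoˡ-≤-nonNeg ⅓ (*-monoˡ-≤-nonNeg M {{nonNegative 0≤M}} X≤3P²) ⟩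
    ⅓ * (M * ((P + P + P) * P))          ≡⟨ regroup ⅓ M P ⟩
    (⅓ * (1ℚ + 1ℚ + 1ℚ)) * (M * (P * P)) ≡⟨ *-identityˡ (M * (P * P)) ⟩
    M * (P * P)                          ∎
    where
    open ≤-Reasoning
    regroup : ∀ c m p → c * (m * ((p + p + p) * p)) ≡ (c * (1ℚ + 1ℚ + 1ℚ)) * (m * (p * p))
    regroup = +-*-Solver.solve 3
      (λ c m p → c :* (m :* ((p :+ p :+ p) :* p)) := (c :* (con 1ℚ :+ con 1ℚ :+ con 1ℚ)) :* (m :* (p :* p)))
      refl
      where open +-*-Solver

open import Data.Nat using (ℕ) renaming (_≤_ to _≤ℕ_)
open import Data.Rational using (ℚ; 0ℚ; _<_; _≤_; _+_; _*_)
open import Data.Rational.Properties using (positive⁻¹)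
open import Data.Product using (Σ; _×_; _,_)
open import Relation.Binary.PropositionalEquality using (subst₂; sym)
open RationalBounds

numTriangles≤numWedgesℚ : ∀ {n} (G : SimpleGraph n) → ℕtoℚ (numTriangles G) ≤ ℕtoℚ (numWedges G)
numTriangles≤numWedgesℚ G = ℕtoℚ-mono-≤ (Counting.numTriangles≤numWedges G)

maxTriOnEdge-square≤ℚ : ∀ {n} (G : SimpleGraph n) →
  ℕtoℚ (maxTriOnEdge G) * ℕtoℚ (maxTriOnEdge G) ≤ ℕtoℚ (numWedges G) + ℕtoℚ (numWedges G)
maxTriOnEdge-square≤ℚ G = subst₂ _≤_ (sym (ℕtoℚ-* Δ Δ)) (ℕtoℚ-double (numWedges G))
  (ℕtoℚ-mono-≤ (Counting.maxTriOnEdge-square≤ G))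
  where Δ = maxTriOnEdge G

-- The hypothesis T ≥ 1 only makes the paper's ratios meaningful; with denominators cleared
-- the inequality holds for every graph.
mainTheorem18 : Σ ℚ (λ c → (0ℚ < c) ×
    ((n : ℕ) (G : SimpleGraph n) → 1 ≤ℕ numTriangles G →
      (s : ℚ) → 0ℚ ≤ s → s * s ≤ ℕtoℚ (numTriangles G) →
        c * (ℕtoℚ (numEdges G) * (ℕtoℚ (maxTriOnEdge G) * ℕtoℚ (numTriangles G) * s
                                   + ℕtoℚ (numTriangles G) * ℕtoℚ (numTriangles G)))
          ≤ ℕtoℚ (numEdges G) * (ℕtoℚ (numWedges G) * ℕtoℚ (numWedges G))))
mainTheorem18 = ⅓ , positive⁻¹ ⅓ , λ n G _ s 0≤s s²≤T →
  ⅓-bound {P = ℕtoℚ (numWedges G)} (ℕtoℚ-nonNeg (numEdges G))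
    (wedge-bound (ℕtoℚ-nonNeg (maxTriOnEdge G)) (ℕtoℚ-nonNeg (numTriangles G))
      (numTriangles≤numWedgesℚ G) (maxTriOnEdge-square≤ℚ G) 0≤s s²≤T)
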